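{- Let $r \ge 1$ and $m \ge r+1$ be integers. Let $G$ be the bipartite graph with parts $A$ and $B$, where each of $A$ and $B$ is a copy of the collection of all subsets of $[m]=\{1,\dots,m\}$ of size between $1$ and $r$, and where $S \in A$ is adjacent to $T \in B$ if and only if $S \cap T = \emptyset$ and $|S| + |T| \ge r+1$. Then $G$ has a perfect matching. -}

module Defs where

open import Data.Nat using (ℕ; _+_; _≤_; suc)
open import Data.Fin.Subset using (Subset; ∣_∣; _∩_; ⊥)
open import Data.Product using (Σ; _×_; proj₁)
open import Relation.Binary.PropositionalEquality using (_≡_)
open import Function.Bundles using (_⤖_; Bijection)

Side : (m r : ℕ) → Set
Side m r = Σ (Subset m) (λ S → (1 ≤ ∣ S ∣) × (∣ S ∣ ≤ r))

Adjacent : (m r : ℕ) → Subset m → Subset m → Set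
Adjacent m r S T = (S ∩ T ≡ ⊥) × (suc r ≤ ∣ S ∣ + ∣ T ∣)

PerfectMatching : (m r : ℕ) → Set
PerfectMatching m r =
  Σ (Side m r ⤖ Side m r)
    (λ f → ∀ (S : Side m r) →
       Adjacent m r (proj₁ S) (proj₁ (Bijection.to f S)))

module Submission where

-- We build the matching as an explicit bijection f on admissible sets with
-- S ∩ f S = ∅ and |S| + |f S| ≥ t, by induction on the ground set.
-- A subset of [m+1] either contains the new point (true ∷ X) or not
-- (false ∷ S).  Given matchings ψ on sizes ≤ r and φ on sizes ≤ r+1 of [m],
-- send true ∷ X to false ∷ ψ X, and false ∷ S to "mark (φ S)": the set φ S
-- itself when it has the maximal size r+1, and φ S plus the new point
-- otherwise.  Images of the two parts are complementary, so this is a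
-- bijection, and disjointness and largeness are inherited from ψ and φ.
--   * allSetsMatching: sizes 0..r, threshold t ≤ min(r, m), all built this way;
--   * nonEmptyMatching: sizes 1..r, threshold r+1, for r < m; the same step,
--     except that the set {new point} takes over the role of ∅.

open import Defs
open import Data.Nat using (ℕ; zero; suc; _≤_; _<_; _+_; _∸_; z≤n; s≤s; s≤s⁻¹; _≟_)
open import Data.Nat.Properties
open import Data.Bool using (true; false)
open import Data.Vec using ([]; _∷_)
open import Data.Fin.Subset using (Subset; ∣_∣; _∩_; ⊥)
open import Data.Fin.Subset.Properties using (∣p∣≤n; ∩-idem)
open import Data.Product using (_×_; _,_; proj₁; proj₂)
open import Relation.Binary.PropositionalEquality
open import Relation.Nullary using (yes; no; ¬_; contradiction)
open import Function.Bundles using (mk↔ₛ′)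
open import Function.Properties.Inverse using (↔⇒⤖)

Sized : ∀ {m} → ℕ → ℕ → Subset m → Set
Sized lo hi S = (lo ≤ ∣ S ∣) × (∣ S ∣ ≤ hi)

record DisjointMatching (m lo hi t : ℕ) : Set where
  field
    to from    : Subset m → Subset m
    to-sized   : ∀ {S} → Sized lo hi S → Sized lo hi (to S)
    from-sized : ∀ {T} → Sized lo hi T → Sized lo hi (from T)
    from-to    : ∀ {S} → Sized lo hi S → from (to S) ≡ S
    to-from    : ∀ {T} → Sized lo hi T → to (from T) ≡ T
    disjoint   : ∀ {S} → Sized lo hi S → S ∩ to S ≡ ⊥
    large      : ∀ {S} → Sized lo hi S → t ≤ ∣ S ∣ + ∣ to S ∣

pred-≤ : ∀ {t n} → t ≤ suc n → t ∸ 1 ≤ n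
pred-≤ = ∸-monoˡ-≤ 1

≤-suc-of-pred : ∀ {t n} → t ∸ 1 ≤ n → t ≤ suc n
≤-suc-of-pred {t} p = ≤-trans (m≤n+m∸n t 1) (s≤s p)

size-0⇒⊥ : ∀ {m} (S : Subset m) → ∣ S ∣ ≤ 0 → S ≡ ⊥
size-0⇒⊥ []          _ = refl
size-0⇒⊥ (false ∷ S) p = cong (false ∷_) (size-0⇒⊥ S p)

identityMatching : ∀ {m lo hi t} →
  (∀ {S : Subset m} → Sized lo hi S → ∣ S ∣ ≤ 0 × t ≤ 0) →
  DisjointMatching m lo hi t
identityMatching onlyEmpty = record
  { to = λ S → S ; from = λ T → T
  ; to-sized = λ s → s ; from-sized = λ s → s
  ; from-to = λ _ → refl ; to-from = λ _ → refl
  ; disjoint = λ {S} s → trans (∩-idem S) (size-0⇒⊥ S (proj₁ (onlyEmpty {S} s)))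
  ; large = λ {S} s → ≤-trans (proj₂ (onlyEmpty {S} s)) z≤n
  }

infix 0 ifSize_is_then_else_
ifSize_is_then_else_ : ∀ {m} {A : Set} → Subset m → ℕ → A → A → A
ifSize T is k then a else b with ∣ T ∣ ≟ k
... | yes _ = a
... | no  _ = b

ifSize-elim : ∀ {m ℓ} {A : Set} (P : A → Set ℓ) (T : Subset m) (k : ℕ) {a b : A} →
  (∣ T ∣ ≡ k → P a) → (¬ ∣ T ∣ ≡ k → P b) → P (ifSize T is k then a else b)
ifSize-elim P T k on-yes on-no with ∣ T ∣ ≟ k
... | yes e = on-yes e
... | no ne = on-no ne

ifSize-yes : ∀ {m} {A : Set} (T : Subset m) {k} {a b : A} →
  ∣ T ∣ ≡ k → (ifSize T is k then a else b) ≡ a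
ifSize-yes T {k} {a} e = ifSize-elim (_≡ a) T k (λ _ → refl) (λ ne → contradiction e ne)

ifSize-no : ∀ {m} {A : Set} (T : Subset m) {k} {a b : A} →
  ¬ ∣ T ∣ ≡ k → (ifSize T is k then a else b) ≡ b
ifSize-no T {k} {b = b} ne = ifSize-elim (_≡ b) T k (λ e → contradiction e ne) (λ _ → refl)

-- Marked sets are the sets of size 1..R of [m+1]
-- which do not have the form "false ∷ T with |T| < R".
mark : ∀ {m} → ℕ → Subset m → Subset (suc m)
mark R U = ifSize U is R then false ∷ U else true ∷ U

module _ {m r : ℕ} where
  private R = suc r

  mark-short : (U : Subset m) → ∣ U ∣ ≤ r → mark R U ≡ true ∷ U
  mark-short U u = ifSize-no U (<⇒≢ (s≤s u))

  mark-sized : (U : Subset m) → ∣ U ∣ ≤ R → Sized 1 R (mark R U)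
  mark-sized U u = ifSize-elim (Sized 1 R) U R
    (λ e → subst (1 ≤_) (sym e) (s≤s z≤n) , u)
    (λ ne → s≤s z≤n , ≤∧≢⇒< u ne)

  mark-avoids : (S U : Subset m) → S ∩ U ≡ ⊥ → (false ∷ S) ∩ mark R U ≡ ⊥
  mark-avoids S U d = ifSize-elim (λ M → (false ∷ S) ∩ M ≡ ⊥) U R
    (λ _ → cong (false ∷_) d) (λ _ → cong (false ∷_) d)

  -- A full U keeps its size R; a short one gains the new point.
  mark-large : ∀ {k} (s : ℕ) (U : Subset m) →
    k ≤ s + R → k ≤ suc (s + ∣ U ∣) → k ≤ s + ∣ mark R U ∣
  mark-large {k} s U full short = ifSize-elim (λ M → k ≤ s + ∣ M ∣) U R
    (λ e → subst (λ n → k ≤ s + n) (sym e) full)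
    (λ _ → subst (k ≤_) (sym (+-suc s ∣ U ∣)) short)

module ExtendAll {m r t : ℕ}
    (ψ : DisjointMatching m 0 r (t ∸ 1))
    (φ : DisjointMatching m 0 (suc r) (t ∸ 1))
    (t≤R : t ≤ suc r) where
  private
    module ψ = DisjointMatching ψ
    module φ = DisjointMatching φ
    R = suc r

  F : Subset (suc m) → Subset (suc m)
  F (true  ∷ X) = false ∷ ψ.to X
  F (false ∷ S) = mark R (φ.to S)

  G : Subset (suc m) → Subset (suc m)
  G (true  ∷ X) = false ∷ φ.from X
  G (false ∷ T) = ifSize T is R then false ∷ φ.from T else true ∷ ψ.from T

  from-mark : (U : Subset m) → G (mark R U) ≡ false ∷ φ.from U
  from-mark U = ifSize-elim (λ M → G M ≡ false ∷ φ.from U) U R (ifSize-yes U) (λ _ → refl)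

  F-sized : ∀ {S} → Sized 0 R S → Sized 0 R (F S)
  F-sized {true  ∷ X} (_ , s≤s x) = z≤n , m≤n⇒m≤1+n (proj₂ (ψ.to-sized (z≤n , x)))
  F-sized {false ∷ S} s           = z≤n , proj₂ (mark-sized (φ.to S) (proj₂ (φ.to-sized s)))

  G-sized : ∀ {T} → Sized 0 R T → Sized 0 R (G T)
  G-sized {true  ∷ X} (_ , s≤s x) = φ.from-sized (z≤n , m≤n⇒m≤1+n x)
  G-sized {false ∷ T} (_ , u)     = ifSize-elim (Sized 0 R) T R
    (λ _ → φ.from-sized (z≤n , u))
    (λ ne → z≤n , s≤s (proj₂ (ψ.from-sized (z≤n , s≤s⁻¹ (≤∧≢⇒< u ne)))))

  G-F : ∀ {S} → Sized 0 R S → G (F S) ≡ S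
  G-F {true  ∷ X} (_ , s≤s x) = begin
    G (false ∷ ψ.to X)       ≡⟨ ifSize-no (ψ.to X) (<⇒≢ (s≤s (proj₂ (ψ.to-sized (z≤n , x))))) ⟩
    true ∷ ψ.from (ψ.to X)   ≡⟨ cong (true ∷_) (ψ.from-to (z≤n , x)) ⟩
    true ∷ X                 ∎
    where open ≡-Reasoning
  G-F {false ∷ S} s = trans (from-mark (φ.to S)) (cong (false ∷_) (φ.from-to s))

  F-G : ∀ {T} → Sized 0 R T → F (G T) ≡ T
  F-G {true  ∷ X} (_ , s≤s x) =
    trans (cong (mark R) (φ.to-from (z≤n , m≤n⇒m≤1+n x))) (mark-short X x)
  F-G {false ∷ T} (_ , u) = ifSize-elim (λ M → F M ≡ false ∷ T) T R
    (λ e → trans (cong (mark R) (φ.to-from (z≤n , u))) (ifSize-yes T e))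
    (λ ne → cong (false ∷_) (ψ.to-from (z≤n , s≤s⁻¹ (≤∧≢⇒< u ne))))

  F-disjoint : ∀ {S} → Sized 0 R S → S ∩ F S ≡ ⊥
  F-disjoint {true  ∷ X} (_ , s≤s x) = cong (false ∷_) (ψ.disjoint (z≤n , x))
  F-disjoint {false ∷ S} s           = mark-avoids S (φ.to S) (φ.disjoint s)

  F-large : ∀ {S} → Sized 0 R S → t ≤ ∣ S ∣ + ∣ F S ∣
  F-large {true  ∷ X} (_ , s≤s x) = ≤-suc-of-pred (ψ.large (z≤n , x))
  F-large {false ∷ S} s           =
    mark-large ∣ S ∣ (φ.to S) (≤-trans t≤R (m≤n+m R ∣ S ∣)) (≤-suc-of-pred (φ.large s))

  matching : DisjointMatching (suc m) 0 R t
  matching = record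
    { to = F ; from = G
    ; to-sized = λ {S} → F-sized {S} ; from-sized = λ {T} → G-sized {T}
    ; from-to = λ {S} → G-F {S} ; to-from = λ {T} → F-G {T}
    ; disjoint = λ {S} → F-disjoint {S} ; large = λ {S} → F-large {S}
    }

allSetsMatching : ∀ m r t → t ≤ r → t ≤ m → DisjointMatching m 0 r t
allSetsMatching zero    r       t _   t≤0 = identityMatching (λ {S} _ → ∣p∣≤n S , t≤0)
allSetsMatching (suc m) zero    t t≤0 _   = identityMatching (λ s → proj₂ s , t≤0)
allSetsMatching (suc m) (suc r) t t≤R t≤m = ExtendAll.matching
  (allSetsMatching m r       (t ∸ 1) (pred-≤ t≤R)                 (pred-≤ t≤m))
  (allSetsMatching m (suc r) (t ∸ 1) (m≤n⇒m≤1+n (pred-≤ t≤R)) (pred-≤ t≤m))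
  t≤R

-- The induction step for nonempty sets of size ≤ R = r+1 with threshold R+1.
-- As in ExtendAll, except that {new point} = true ∷ ∅ is treated like ∅.
module ExtendNonEmpty {m r : ℕ}
    (ψ : DisjointMatching m 1 r (suc r))
    (φ : DisjointMatching m 0 (suc r) (suc r)) where
  private
    module ψ = DisjointMatching ψ
    module φ = DisjointMatching φ
    R = suc r

  embed : Subset m → Subset (suc m)
  embed S = ifSize S is 0 then true ∷ S else false ∷ S

  F : Subset (suc m) → Subset (suc m)
  F (true  ∷ X) = ifSize X is 0 then mark R (φ.to X) else false ∷ ψ.to X
  F (false ∷ S) = mark R (φ.to S)

  G : Subset (suc m) → Subset (suc m)
  G (true  ∷ X) = embed (φ.from X)
  G (false ∷ T) = ifSize T is R then embed (φ.from T) else true ∷ ψ.from T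

  from-mark : (U : Subset m) → G (mark R U) ≡ embed (φ.from U)
  from-mark U = ifSize-elim (λ M → G M ≡ embed (φ.from U)) U R (ifSize-yes U) (λ _ → refl)

  to-embed : (S : Subset m) → F (embed S) ≡ mark R (φ.to S)
  to-embed S = ifSize-elim (λ M → F M ≡ mark R (φ.to S)) S 0 (ifSize-yes S) (λ _ → refl)

  partner-of-∅ : (X : Subset m) → ∣ X ∣ ≡ 0 → ∣ X ∣ ≤ R → ∣ φ.to X ∣ ≡ R
  partner-of-∅ X e x = ≤-antisym (proj₂ (φ.to-sized {X} (z≤n , x)))
    (subst (λ n → R ≤ n + ∣ φ.to X ∣) e (φ.large {X} (z≤n , x)))

  embed-sized : (S : Subset m) → ∣ S ∣ ≤ R → Sized 1 R (embed S)
  embed-sized S u = ifSize-elim (Sized 1 R) S 0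
    (λ e → s≤s z≤n , s≤s (subst (_≤ r) (sym e) z≤n))
    (λ ne → n≢0⇒n>0 ne , u)

  F-sized : ∀ {S} → Sized 1 R S → Sized 1 R (F S)
  F-sized {true  ∷ X} (_ , s≤s x) = ifSize-elim (Sized 1 R) X 0
    (λ _ → mark-sized (φ.to X) (proj₂ (φ.to-sized (z≤n , m≤n⇒m≤1+n x))))
    (λ ne → let (a , b) = ψ.to-sized (n≢0⇒n>0 ne , x) in a , m≤n⇒m≤1+n b)
  F-sized {false ∷ S} (_ , u)     = mark-sized (φ.to S) (proj₂ (φ.to-sized (z≤n , u)))

  G-sized : ∀ {T} → Sized 1 R T → Sized 1 R (G T)
  G-sized {true  ∷ X} (_ , s≤s x) = embed-sized (φ.from X) (proj₂ (φ.from-sized (z≤n , m≤n⇒m≤1+n x)))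
  G-sized {false ∷ T} (a , u)     = ifSize-elim (Sized 1 R) T R
    (λ _ → embed-sized (φ.from T) (proj₂ (φ.from-sized (z≤n , u))))
    (λ ne → s≤s z≤n , s≤s (proj₂ (ψ.from-sized (a , s≤s⁻¹ (≤∧≢⇒< u ne)))))

  G-F : ∀ {S} → Sized 1 R S → G (F S) ≡ S
  G-F {true  ∷ X} (_ , s≤s x) = ifSize-elim (λ M → G M ≡ true ∷ X) X 0
    (λ e → begin
      G (mark R (φ.to X))      ≡⟨ from-mark (φ.to X) ⟩
      embed (φ.from (φ.to X))  ≡⟨ cong embed (φ.from-to (z≤n , m≤n⇒m≤1+n x)) ⟩
      embed X                  ≡⟨ ifSize-yes X e ⟩
      true ∷ X                 ∎)
    (λ ne → let dX = (n≢0⇒n>0 ne , x) in begin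
      G (false ∷ ψ.to X)       ≡⟨ ifSize-no (ψ.to X) (<⇒≢ (s≤s (proj₂ (ψ.to-sized dX)))) ⟩
      true ∷ ψ.from (ψ.to X)   ≡⟨ cong (true ∷_) (ψ.from-to dX) ⟩
      true ∷ X                 ∎)
    where open ≡-Reasoning
  G-F {false ∷ S} (a , u) = begin
    G (mark R (φ.to S))        ≡⟨ from-mark (φ.to S) ⟩
    embed (φ.from (φ.to S))    ≡⟨ cong embed (φ.from-to (z≤n , u)) ⟩
    embed S                    ≡⟨ ifSize-no S (>⇒≢ a) ⟩
    false ∷ S                  ∎
    where open ≡-Reasoning

  F-G : ∀ {T} → Sized 1 R T → F (G T) ≡ T
  F-G {true  ∷ X} (_ , s≤s x) = begin
    F (embed (φ.from X))       ≡⟨ to-embed (φ.from X) ⟩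
    mark R (φ.to (φ.from X))   ≡⟨ cong (mark R) (φ.to-from (z≤n , m≤n⇒m≤1+n x)) ⟩
    mark R X                   ≡⟨ mark-short X x ⟩
    true ∷ X                   ∎
    where open ≡-Reasoning
  F-G {false ∷ T} (a , u) = ifSize-elim (λ M → F M ≡ false ∷ T) T R
    (λ e → begin
      F (embed (φ.from T))     ≡⟨ to-embed (φ.from T) ⟩
      mark R (φ.to (φ.from T)) ≡⟨ cong (mark R) (φ.to-from (z≤n , u)) ⟩
      mark R T                 ≡⟨ ifSize-yes T e ⟩
      false ∷ T                ∎)
    (λ ne → let dT = (a , s≤s⁻¹ (≤∧≢⇒< u ne)) in begin
      F (true ∷ ψ.from T)      ≡⟨ ifSize-no (ψ.from T) (>⇒≢ (proj₁ (ψ.from-sized dT))) ⟩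
      false ∷ ψ.to (ψ.from T)  ≡⟨ cong (false ∷_) (ψ.to-from dT) ⟩
      false ∷ T                ∎)
    where open ≡-Reasoning

  F-disjoint : ∀ {S} → Sized 1 R S → S ∩ F S ≡ ⊥
  F-disjoint {true  ∷ X} (_ , s≤s x) = ifSize-elim (λ M → (true ∷ X) ∩ M ≡ ⊥) X 0
    (λ e → trans (cong ((true ∷ X) ∩_) (ifSize-yes (φ.to X) (partner-of-∅ X e x′)))
                 (cong (false ∷_) (φ.disjoint (z≤n , x′))))
    (λ ne → cong (false ∷_) (ψ.disjoint (n≢0⇒n>0 ne , x)))
    where x′ = m≤n⇒m≤1+n x
  F-disjoint {false ∷ S} (_ , u)     = mark-avoids S (φ.to S) (φ.disjoint (z≤n , u))

  F-large : ∀ {S} → Sized 1 R S → suc R ≤ ∣ S ∣ + ∣ F S ∣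
  F-large {true  ∷ X} (_ , s≤s x) = ifSize-elim (λ M → suc R ≤ suc (∣ X ∣ + ∣ M ∣)) X 0
    (λ _ → s≤s (mark-large ∣ X ∣ (φ.to X) (m≤n+m R ∣ X ∣) (m≤n⇒m≤1+n (φ.large (z≤n , x′)))))
    (λ ne → s≤s (ψ.large (n≢0⇒n>0 ne , x)))
    where x′ = m≤n⇒m≤1+n x
  F-large {false ∷ S} (a , u)     =
    mark-large ∣ S ∣ (φ.to S) (+-monoˡ-≤ R a) (s≤s (φ.large (z≤n , u)))

  matching : DisjointMatching (suc m) 1 R (suc R)
  matching = record
    { to = F ; from = G
    ; to-sized = λ {S} → F-sized {S} ; from-sized = λ {T} → G-sized {T}
    ; from-to = λ {S} → G-F {S} ; to-from = λ {T} → F-G {T}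
    ; disjoint = λ {S} → F-disjoint {S} ; large = λ {S} → F-large {S}
    }

nonEmptyMatching : ∀ m r → r < m → DisjointMatching m 1 r (suc r)
nonEmptyMatching m       zero    _         =
  identityMatching (λ (a , b) → contradiction (≤-trans a b) λ ())
nonEmptyMatching (suc m) (suc r) (s≤s r<m) = ExtendNonEmpty.matching
  (nonEmptyMatching m r r<m)
  (allSetsMatching m (suc r) (suc r) ≤-refl r<m)

toPerfectMatching : ∀ {m r} → DisjointMatching m 1 r (suc r) → PerfectMatching m r
toPerfectMatching {m} {r} M =
  ↔⇒⤖ (mk↔ₛ′ to′ from′ (λ (T , t) → Side-≡ (to-from t)) (λ (S , s) → Side-≡ (from-to s)))
  , λ (S , s) → disjoint s , large s
  where
    open DisjointMatching M
    to′ from′ : Side m r → Side m r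
    to′   (S , s) = to S , to-sized s
    from′ (T , t) = from T , from-sized t
    Side-≡ : ∀ {S S′} {s : Sized 1 r S} {s′ : Sized 1 r S′} →
      S ≡ S′ → _≡_ {A = Side m r} (S , s) (S′ , s′)
    Side-≡ {s = a , b} {a′ , b′} refl = cong₂ (λ p q → _ , p , q) (≤-irrelevant a a′) (≤-irrelevant b b′)

corollary2p2 : (r m : ℕ) → 1 ≤ r → suc r ≤ m → PerfectMatching m r
corollary2p2 r m _ r<m = toPerfectMatching (nonEmptyMatching m r r<m)
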